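{- Let $n\ge1$ and $N=2^n$. Let $\phi\colon[N]\times[N]\to\{0,1\}^{2n}$ be the bijection $\phi(u,v)=\mathrm{bin}(u)\mathrm{bin}(v)$. Then for every $G\subseteq[N]\times[N]$, $$D_\cap(\phi(G)\mid\mathcal B_{2n})\;\ge\;D_\cap(G\mid\mathcal G_{N,N}).$$
   Context: For a nonempty finite set $\Gamma$ and $\mathcal B\subseteq\mathcal P(\Gamma)$, a sequence $A_1,\dots,A_t$ ($t\ge1$) of subsets of $\Gamma$ generates $A$ from $\mathcal B$ if $A_t=A$ and each $A_i$ equals $X\cup Y$ or $X\cap Y$ for some (not necessarily distinct) $X,Y\in\mathcal B\cup\{A_1,\dots,A_{i-1}\}$. $D_\cap(A\mid\mathcal B)$ is the minimum number of intersection steps over all sequences generating $A$ from $\mathcal B$ ($\infty$ if none). $\mathcal G_{N,N}=\{R_1,\dots,R_N,C_1,\dots,C_N\}$ on $[N]\times[N]$, with $R_i=\{(i,j):j\in[N]\}$, $C_j=\{(i,j):i\in[N]\}$. $\mathcal B_{2n}=\{B_1,\dots,B_{2n},B_1^c,\dots,B_{2n}^c\}$ on $\{0,1\}^{2n}$, with $B_i=\{v:v_i=1\}$ and complements taken in $\{0,1\}^{2n}$. $\mathrm{bin}\colon[N]\to\{0,1\}^n$ maps $k$ to the $n$-bit binary representation (most significant bit first) of $k-1$; $\mathrm{bin}(u)\mathrm{bin}(v)$ denotes concatenation. -}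

module Defs where

open import Data.Nat using (ℕ; zero; suc; _+_; _≤_; _^_; _%_; _/_; _≡ᵇ_)
open import Data.Bool using (Bool; true; false; _∧_; _∨_; not)
open import Data.Fin using (Fin; toℕ)
open import Data.Fin.Base using () 
open import Data.List using (List; []; _∷_; _++_; map; concatMap; allFin)
open import Data.Bool.ListAction using (any)
open import Data.List.Membership.Propositional using (_∈_)
open import Data.Vec using (Vec; []; _∷_; lookup; reverse) renaming (_++_ to _++ᵥ_)
open import Data.Vec.Properties using (≡-dec)
open import Data.Bool.Properties using () renaming (_≟_ to _≟B_)
open import Data.Product using (Σ; ∃; _×_; _,_)
open import Relation.Binary.PropositionalEquality using (_≡_)
open import Relation.Nullary.Decidable using (⌊_⌋)

SubsetOf : Set → Set
SubsetOf Γ = Γ → Bool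

_≐_ : {Γ : Set} → SubsetOf Γ → SubsetOf Γ → Set
A ≐ B = ∀ x → A x ≡ B x

_∪ˢ_ : {Γ : Set} → SubsetOf Γ → SubsetOf Γ → SubsetOf Γ
(A ∪ˢ B) x = A x ∨ B x

_∩ˢ_ : {Γ : Set} → SubsetOf Γ → SubsetOf Γ → SubsetOf Γ
(A ∩ˢ B) x = A x ∧ B x

data Op : Set where
  ∪op ∩op : Op

apply : {Γ : Set} → Op → SubsetOf Γ → SubsetOf Γ → SubsetOf Γ
apply ∪op X Y = X ∪ˢ Y
apply ∩op X Y = X ∩ˢ Y

cost : Op → ℕ
cost ∪op = 0
cost ∩op = 1

-- GenSeq 𝓑 prev k : 'prev' is a (reversed: newest first) list A_i,…,A_1
-- forming a valid sequence from 𝓑 in which k steps are intersection steps.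
data GenSeq {Γ : Set} (𝓑 : List (SubsetOf Γ)) : List (SubsetOf Γ) → ℕ → Set where
  []   : GenSeq 𝓑 [] 0
  step : ∀ {prev k} → GenSeq 𝓑 prev k →
         (o : Op) (X Y : SubsetOf Γ) → X ∈ (𝓑 ++ prev) → Y ∈ (𝓑 ++ prev) →
         GenSeq 𝓑 (apply o X Y ∷ prev) (k + cost o)

-- "D_∩(A | 𝓑) ≤ k": some sequence (t ≥ 1) generates A from 𝓑 using at most
-- k intersection steps.
DcapLe : {Γ : Set} → SubsetOf Γ → List (SubsetOf Γ) → ℕ → Set
DcapLe {Γ} A 𝓑 k =
  Σ (SubsetOf Γ) λ Aₜ → Σ (List (SubsetOf Γ)) λ prev → Σ ℕ λ m →
    GenSeq 𝓑 (Aₜ ∷ prev) m × m ≤ k × Aₜ ≐ A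

-- the grid [N]×[N], with [N] represented by Fin N (k ↦ index k-1)
Grid : ℕ → Set
Grid N = Fin N × Fin N

Row : {N : ℕ} → Fin N → SubsetOf (Grid N)
Row i (a , b) = ⌊ Data.Fin._≟_ a i ⌋

Col : {N : ℕ} → Fin N → SubsetOf (Grid N)
Col j (a , b) = ⌊ Data.Fin._≟_ b j ⌋

𝓖 : (N : ℕ) → List (SubsetOf (Grid N))
𝓖 N = map Row (allFin N) ++ map Col (allFin N)

Cube : ℕ → Set
Cube m = Vec Bool m

Bcoord : {m : ℕ} → Fin m → SubsetOf (Cube m)
Bcoord i v = lookup v i

Bcoordᶜ : {m : ℕ} → Fin m → SubsetOf (Cube m)
Bcoordᶜ i v = not (lookup v i)

𝓑cube : (m : ℕ) → List (SubsetOf (Cube m))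
𝓑cube m = map Bcoord (allFin m) ++ map Bcoordᶜ (allFin m)

lsbBits : (n : ℕ) → ℕ → Vec Bool n
lsbBits zero    m = []
lsbBits (suc n) m = (m % 2 ≡ᵇ 1) ∷ lsbBits n (m / 2)

-- bin k  for k ∈ [2^n] (as Fin (2^n), i.e. toℕ k = k-1)
bin : (n : ℕ) → Fin (2 ^ n) → Vec Bool n
bin n k = reverse (lsbBits n (toℕ k))

φ : (n : ℕ) → Grid (2 ^ n) → Cube (n + n)
φ n (u , v) = bin n u ++ᵥ bin n v

image : (n : ℕ) → SubsetOf (Grid (2 ^ n)) → SubsetOf (Cube (n + n))
image n G w =
  any (λ p → G p ∧ ⌊ ≡-dec _≟B_ (φ n p) w ⌋)
      (concatMap (λ u → map (λ v → (u , v)) (allFin (2 ^ n))) (allFin (2 ^ n)))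

-- Pull a generating sequence on the cube back along φ. Pulling back commutes
-- with ∪ and ∩, so every step becomes a grid step of the same kind. The
-- pullback of a generator B_i or B_i^c is the union of the rows (or columns)
-- whose index has the corresponding bit equal to 1 or 0; this union is
-- nonempty (the indices N and 1 have all bits 1 and all bits 0), so it is
-- produced from 𝓖 by union steps alone, at no cost. Since φ is injective,
-- the pullback of φ(G) is G.
module Submission where

open import Defs
open import Data.Bool using (Bool; true; false; T; T?; not; _∨_; _∧_)
open import Data.Bool.ListAction using (any)
open import Data.Bool.Properties using (∨-idem; ∨-identityʳ; T-∧; T-≡; T-not-≡) renaming (_≟_ to _≟ᴮ_)
open import Data.Empty using (⊥-elim)
open import Data.Fin as F using (Fin)
open import Data.Fin.Properties using (toℕ-injective; toℕ<n; toℕ-fromℕ<)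
open import Data.List using (List; []; _∷_; _++_; map; concatMap; filterᵇ; allFin)
open import Data.List.NonEmpty as List⁺ using (List⁺; _∷_; toList; foldr₁)
open import Data.List.Membership.Propositional using (_∈_; find; lose)
open import Data.List.Membership.Propositional.Properties using (∈-++⁺ˡ; ∈-++⁺ʳ; ∈-map⁺; ∈-map⁻; ∈-filter⁺; ∈-filter⁻; ∈-allFin; ∈-concatMap⁺)
open import Data.List.Relation.Binary.Subset.Propositional using (_⊆_)
open import Data.List.Relation.Binary.Subset.Propositional.Properties using (Any-resp-⊆; ++⁺ʳ)
open import Data.List.Relation.Unary.All as All using (All; []; _∷_)
open import Data.List.Relation.Unary.All.Properties using (tabulate⁺) renaming (++⁺ to All-++⁺; map⁺ to All-map⁺; map⁻ to All-map⁻)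
open import Data.List.Relation.Unary.Any using (Any; here; there)
open import Data.List.Relation.Unary.Any.Properties using (any⁺; any⁻) renaming (map⁻ to Any-map⁻)
open import Data.Nat using (ℕ; zero; suc; _+_; _*_; _^_; _<_; _≤_; z≤n; s≤s; _%_; _/_; _≡ᵇ_)
open import Data.Nat.DivMod using (m≡m%n+[m/n]*n; m%n<n; m<n*o⇒m/o<n; [m+kn]%n≡m%n; +-distrib-/-∣ʳ; m*n/n≡m)
open import Data.Nat.Divisibility using (n∣m*n)
open import Data.Nat.Properties using (+-identityʳ; *-comm; *-monoˡ-≤; m^n>0)
open import Data.Product using (Σ; _×_; _,_; proj₁; proj₂)
open import Data.Sum using (inj₁; inj₂; [_,_]′)
open import Data.Unit using (tt)
open import Data.Vec as Vec using (_∷_; replicate; reverse; lookup)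
open import Data.Vec.Properties using (map-const; map-reverse; lookup-replicate; lookup-splitAt; ∷-injectiveˡ; ∷-injectiveʳ; ≡-dec; ++-injective; reverse-injective)
open import Function using (_∘_; id; const; _⇔_; mk⇔; Equivalence)
open import Relation.Nullary.Decidable using (⌊_⌋; toWitness; fromWitness)
open import Relation.Binary.PropositionalEquality using (_≡_; _≗_; refl; sym; trans; cong; cong₂; subst; module ≡-Reasoning)
open ≡-Reasoning

T-⇔⇒≡ : ∀ {a b} → T a ⇔ T b → a ≡ b
T-⇔⇒≡ {false} {false} _   = refl
T-⇔⇒≡ {false} {true}  a⇔b = ⊥-elim (Equivalence.from a⇔b tt)
T-⇔⇒≡ {true}  {false} a⇔b = ⊥-elim (Equivalence.to a⇔b tt)
T-⇔⇒≡ {true}  {true}  _   = refl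

module _ {Γ : Set} where

  ⋃⁺ : List⁺ (SubsetOf Γ) → SubsetOf Γ
  ⋃⁺ = foldr₁ _∪ˢ_

  ⋃⁺-apply : ∀ X Xs x → ⋃⁺ (X ∷ Xs) x ≡ any (λ Y → Y x) (X ∷ Xs)
  ⋃⁺-apply X []       x = sym (∨-identityʳ (X x))
  ⋃⁺-apply X (Y ∷ Ys) x = cong₂ _∨_ refl (⋃⁺-apply Y Ys x)

  T-⋃⁺ : ∀ Xs x → T (⋃⁺ Xs x) ⇔ Any (λ X → T (X x)) (toList Xs)
  T-⋃⁺ (X ∷ Xs) x rewrite ⋃⁺-apply X Xs x =
    mk⇔ (any⁻ (λ Y → Y x) (X ∷ Xs)) (any⁺ (λ Y → Y x))

  NonemptyUnionOf : List (SubsetOf Γ) → SubsetOf Γ → Set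
  NonemptyUnionOf 𝓑 Z = Σ (List⁺ (SubsetOf Γ)) λ Xs → toList Xs ⊆ 𝓑 × Z ≗ ⋃⁺ Xs

  NonemptyUnionOf-resp : ∀ {𝓑 Z₁ Z₂} → Z₁ ≗ Z₂ → NonemptyUnionOf 𝓑 Z₂ → NonemptyUnionOf 𝓑 Z₁
  NonemptyUnionOf-resp Z₁≗Z₂ (Xs , Xs⊆𝓑 , Z₂≗) = Xs , Xs⊆𝓑 , λ x → trans (Z₁≗Z₂ x) (Z₂≗ x)

  Available : List (SubsetOf Γ) → List (SubsetOf Γ) → SubsetOf Γ → Set
  Available 𝓑 Q Z = Any (Z ≗_) (𝓑 ++ Q)

  DcapLe-resp-≗ : ∀ {A B : SubsetOf Γ} {𝓑 k} → A ≗ B → DcapLe A 𝓑 k → DcapLe B 𝓑 k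
  DcapLe-resp-≗ A≗B (Aₜ , prev , m , g , m≤k , Aₜ≐A) =
    Aₜ , prev , m , g , m≤k , λ x → trans (Aₜ≐A x) (A≗B x)

  module _ {𝓑 : List (SubsetOf Γ)} where

    available-mono : ∀ {Q Q′ Z} → Q ⊆ Q′ → Available 𝓑 Q Z → Available 𝓑 Q′ Z
    available-mono Q⊆Q′ = Any-resp-⊆ (++⁺ʳ 𝓑 Q⊆Q′)

    ⋃⁺-generate : ∀ {Q} X Xs → GenSeq 𝓑 Q 0 → X ∷ Xs ⊆ 𝓑 →
                  Σ (List (SubsetOf Γ)) λ Q′ → GenSeq 𝓑 Q′ 0 × Q ⊆ Q′ × ⋃⁺ (X ∷ Xs) ∈ 𝓑 ++ Q′
    ⋃⁺-generate {Q} X [] g Xs⊆𝓑 = Q , g , id , ∈-++⁺ˡ (Xs⊆𝓑 (here refl))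
    ⋃⁺-generate X (Y ∷ Ys) g Xs⊆𝓑 with ⋃⁺-generate Y Ys g (Xs⊆𝓑 ∘ there)
    ... | Q , gQ , ⊆Q , U∈ =
      _ , step gQ ∪op X _ (∈-++⁺ˡ (Xs⊆𝓑 (here refl))) U∈ , there ∘ ⊆Q , ∈-++⁺ʳ 𝓑 (here refl)

    generate-unions : ∀ {L} → All (NonemptyUnionOf 𝓑) L →
                   Σ (List (SubsetOf Γ)) λ P → GenSeq 𝓑 P 0 × All (Available 𝓑 P) L
    generate-unions [] = [] , [] , []
    generate-unions ((X ∷ Xs , Xs⊆𝓑 , Z≗) ∷ unions) with generate-unions unions
    ... | P , gP , avail with ⋃⁺-generate X Xs gP Xs⊆𝓑
    ...   | Q , gQ , P⊆Q , U∈ = Q , gQ , lose U∈ Z≗ ∷ All.map (available-mono P⊆Q) avail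

    available⇒DcapLe : ∀ {Q m k Z} → GenSeq 𝓑 Q m → m ≤ k → Available 𝓑 Q Z → DcapLe Z 𝓑 k
    available⇒DcapLe {m = m} {k} g m≤k avail with find avail
    ... | X , X∈ , Z≗X =
      X ∪ˢ X , _ , m + 0 , step g ∪op X X X∈ X∈ , subst (_≤ k) (sym (+-identityʳ m)) m≤k ,
      λ x → trans (∨-idem (X x)) (sym (Z≗X x))

module _ {Γ Γ′ : Set} (ψ : Γ′ → Γ) {𝓑 : List (SubsetOf Γ)} {𝓑′ : List (SubsetOf Γ′)} where

  Covers : List (SubsetOf Γ′) → List (SubsetOf Γ) → Set
  Covers Q L = All (λ X → Available 𝓑′ Q (X ∘ ψ)) L

  apply-pullback : ∀ o {X Y X′ Y′} → X ∘ ψ ≗ X′ → Y ∘ ψ ≗ Y′ → apply o X Y ∘ ψ ≗ apply o X′ Y′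
  apply-pullback ∪op X≗ Y≗ x = cong₂ _∨_ (X≗ x) (Y≗ x)
  apply-pullback ∩op X≗ Y≗ x = cong₂ _∧_ (X≗ x) (Y≗ x)

  GenSeq-pullback : ∀ {P} → GenSeq 𝓑′ P 0 → Covers P 𝓑 → ∀ {prev k} → GenSeq 𝓑 prev k →
                    Σ (List (SubsetOf Γ′)) λ Q → GenSeq 𝓑′ Q k × Covers Q 𝓑 × Covers Q prev
  GenSeq-pullback {P} gP covP [] = P , gP , covP , []
  GenSeq-pullback gP covP (step g o X Y X∈ Y∈) with GenSeq-pullback gP covP g
  ... | Q , gQ , cov𝓑 , covPrev with find (All.lookup (All-++⁺ cov𝓑 covPrev) X∈)
                                   | find (All.lookup (All-++⁺ cov𝓑 covPrev) Y∈)
  ...   | X′ , X′∈ , X≗ | Y′ , Y′∈ , Y≗ =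
    apply o X′ Y′ ∷ Q , step gQ o X′ Y′ X′∈ Y′∈ ,
    All.map (available-mono there) cov𝓑 ,
    lose (∈-++⁺ʳ 𝓑′ (here refl)) (apply-pullback o X≗ Y≗) ∷ All.map (available-mono there) covPrev

  DcapLe-pullback : ∀ {A k} → All (λ X → NonemptyUnionOf 𝓑′ (X ∘ ψ)) 𝓑 →
                    DcapLe A 𝓑 k → DcapLe (A ∘ ψ) 𝓑′ k
  DcapLe-pullback unions (Aₜ , prev , m , g , m≤k , Aₜ≐A)
    with generate-unions (All-map⁺ {f = λ X → X ∘ ψ} unions)
  ... | P , gP , avail with GenSeq-pullback gP (All-map⁻ avail) g
  ...   | Q , gQ , _ , Aₜ-avail ∷ _ =
    DcapLe-resp-≗ (λ x → Aₜ≐A (ψ x)) (available⇒DcapLe gQ m≤k Aₜ-avail)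

module _ {Γ : Set} {N : ℕ} (π : Γ → Fin N) where

  fibre : Fin N → SubsetOf Γ
  fibre u x = ⌊ π x F.≟ u ⌋

  fibres-union : ∀ {𝓑} → (∀ u → fibre u ∈ 𝓑) → (f : Fin N → Bool) {u₀ : Fin N} → T (f u₀) →
                 NonemptyUnionOf 𝓑 (f ∘ π)
  fibres-union {𝓑} fibre∈𝓑 f {u₀} fu₀ =
    List⁺.map fibre us , fibres⊆𝓑 , λ x → T-⇔⇒≡ (mk⇔ (⊆⋃ x) (⋃⊆ x))
    where
    us : List⁺ (Fin N)
    us = u₀ ∷ filterᵇ f (allFin N)

    f-on-us : ∀ {u} → u ∈ toList us → T (f u)
    f-on-us (here refl) = fu₀
    f-on-us (there u∈)  = proj₂ (∈-filter⁻ (T? ∘ f) {xs = allFin N} u∈)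

    fibres⊆𝓑 : toList (List⁺.map fibre us) ⊆ 𝓑
    fibres⊆𝓑 X∈ with ∈-map⁻ fibre X∈
    ... | u , _ , refl = fibre∈𝓑 u

    ⊆⋃ : ∀ x → T (f (π x)) → T (⋃⁺ (List⁺.map fibre us) x)
    ⊆⋃ x fπx = Equivalence.from (T-⋃⁺ (List⁺.map fibre us) x)
      (lose (∈-map⁺ fibre (there (∈-filter⁺ (T? ∘ f) (∈-allFin (π x)) fπx))) (fromWitness refl))

    ⋃⊆ : ∀ x → T (⋃⁺ (List⁺.map fibre us) x) → T (f (π x))
    ⋃⊆ x x∈⋃ with find (Any-map⁻ (Equivalence.to (T-⋃⁺ (List⁺.map fibre us) x) x∈⋃))
    ... | u , u∈ , x∈fibre rewrite toWitness x∈fibre = f-on-us u∈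

-- Row u and Col u are, definitionally, the fibres over u of proj₁ and proj₂.
Row∈𝓖 : ∀ {N} (u : Fin N) → Row u ∈ 𝓖 N
Row∈𝓖 u = ∈-++⁺ˡ (∈-map⁺ Row (∈-allFin u))

Col∈𝓖 : ∀ {N} (u : Fin N) → Col u ∈ 𝓖 N
Col∈𝓖 {N} u = ∈-++⁺ʳ (map Row (allFin N)) (∈-map⁺ Col (∈-allFin u))

lsbBits-zero : ∀ n → lsbBits n 0 ≡ replicate n false
lsbBits-zero zero    = refl
lsbBits-zero (suc n) = cong (false ∷_) (lsbBits-zero n)

lsbBits-odd : ∀ n m → lsbBits (suc n) (1 + m * 2) ≡ true ∷ lsbBits n m
lsbBits-odd n m = cong₂ _∷_ (cong (_≡ᵇ 1) ([m+kn]%n≡m%n 1 m 2)) (cong (lsbBits n) half)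
  where
  half : (1 + m * 2) / 2 ≡ m
  half = trans (+-distrib-/-∣ʳ 1 {d = 2} (n∣m*n m)) (m*n/n≡m m 2)

lsbBits-ones : ∀ n → Σ ℕ λ m → m < 2 ^ n × lsbBits n m ≡ replicate n true
lsbBits-ones zero = 0 , s≤s z≤n , refl
lsbBits-ones (suc n) with lsbBits-ones n
... | m , m<2ⁿ , ones = 1 + m * 2 , bound , trans (lsbBits-odd n m) (cong (true ∷_) ones)
  where
  bound : 1 + m * 2 < 2 ^ suc n
  bound = subst (1 + m * 2 <_) (*-comm (2 ^ n) 2) (*-monoˡ-≤ 2 m<2ⁿ)

bit-injective : ∀ {x y} → x < 2 → y < 2 → (x ≡ᵇ 1) ≡ (y ≡ᵇ 1) → x ≡ y
bit-injective {0} {0} _ _ _ = refl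
bit-injective {1} {1} _ _ _ = refl
bit-injective {0} {1} _ _ ()
bit-injective {1} {0} _ _ ()
bit-injective {suc (suc _)} (s≤s (s≤s ())) _ _
bit-injective {_} {suc (suc _)} _ (s≤s (s≤s ())) _

lsbBits-injective : ∀ n {m m′} → m < 2 ^ n → m′ < 2 ^ n → lsbBits n m ≡ lsbBits n m′ → m ≡ m′
lsbBits-injective zero {0} {0} _ _ _ = refl
lsbBits-injective zero {suc _} (s≤s ()) _ _
lsbBits-injective zero {_} {suc _} _ (s≤s ()) _
lsbBits-injective (suc n) {m} {m′} m< m′< eq = begin
  m                   ≡⟨ m≡m%n+[m/n]*n m 2 ⟩
  m % 2 + m / 2 * 2   ≡⟨ cong₂ (λ r q → r + q * 2) low high ⟩
  m′ % 2 + m′ / 2 * 2 ≡⟨ m≡m%n+[m/n]*n m′ 2 ⟨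
  m′                  ∎
  where
  half< : ∀ {k} → k < 2 ^ suc n → k / 2 < 2 ^ n
  half< {k} k< = m<n*o⇒m/o<n (subst (k <_) (*-comm 2 (2 ^ n)) k<)
  low : m % 2 ≡ m′ % 2
  low = bit-injective (m%n<n m 2) (m%n<n m′ 2) (∷-injectiveˡ eq)
  high : m / 2 ≡ m′ / 2
  high = lsbBits-injective n (half< m<) (half< m′<) (∷-injectiveʳ eq)

reverse-replicate : ∀ {A : Set} n (x : A) → reverse (replicate n x) ≡ replicate n x
reverse-replicate n x = begin
  reverse (replicate n x)                     ≡⟨ cong reverse (map-const (replicate n x) x) ⟨
  reverse (Vec.map (const x) (replicate n x)) ≡⟨ map-reverse (const x) (replicate n x) ⟨
  Vec.map (const x) (reverse (replicate n x)) ≡⟨ map-const (reverse (replicate n x)) x ⟩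
  replicate n x                               ∎

bin-injective : ∀ n {u v : Fin (2 ^ n)} → bin n u ≡ bin n v → u ≡ v
bin-injective n {u} {v} eq =
  toℕ-injective (lsbBits-injective n (toℕ<n u) (toℕ<n v) (reverse-injective eq))

φ-injective : ∀ n {p q : Grid (2 ^ n)} → φ n p ≡ φ n q → p ≡ q
φ-injective n {u , v} {u′ , v′} eq with ++-injective (bin n u) (bin n u′) eq
... | u≡u′ , v≡v′ = cong₂ _,_ (bin-injective n u≡u′) (bin-injective n v≡v′)

image-φ : ∀ n G → image n G ∘ φ n ≗ G
image-φ n G p = T-⇔⇒≡ (mk⇔ image⊆G G⊆image)
  where
  N = 2 ^ n
  row : Fin N → List (Grid N)
  row u = map (u ,_) (allFin N)
  member : Grid N → Bool
  member q = G q ∧ ⌊ ≡-dec _≟ᴮ_ (φ n q) (φ n p) ⌋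

  G⊆image : T (G p) → T (image n G (φ n p))
  G⊆image Gp = any⁺ member (lose p∈grid (Equivalence.from T-∧ (Gp , fromWitness refl)))
    where
    p∈grid = ∈-concatMap⁺ row (lose (∈-allFin (proj₁ p)) (∈-map⁺ (proj₁ p ,_) (∈-allFin (proj₂ p))))

  image⊆G : T (image n G (φ n p)) → T (G p)
  image⊆G t with find (any⁻ member (concatMap row (allFin N)) t)
  ... | q , _ , member-q with Equivalence.to (T-∧ {G q}) member-q
  ...   | Gq , φq≡φp rewrite φ-injective n (toWitness φq≡φp) = Gq

module _ (n : ℕ) where

  private
    N : ℕ
    N = 2 ^ n

  bit : Fin n → Fin N → Bool
  bit j u = lookup (bin n u) j

  constant-bits : ∀ {m} (m<N : m < N) b → lsbBits n m ≡ replicate n b → ∀ j → bit j (F.fromℕ< m<N) ≡ b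
  constant-bits {m} m<N b bits j = begin
    bit j (F.fromℕ< m<N)               ≡⟨ cong (λ k → lookup (reverse (lsbBits n k)) j) (toℕ-fromℕ< m<N) ⟩
    lookup (reverse (lsbBits n m)) j   ≡⟨ cong (λ v → lookup (reverse v) j) bits ⟩
    lookup (reverse (replicate n b)) j ≡⟨ cong (λ v → lookup v j) (reverse-replicate n b) ⟩
    lookup (replicate n b) j           ≡⟨ lookup-replicate j b ⟩
    b                                  ∎

  lookup-φ : ∀ i p → lookup (φ n p) i ≡ [ (λ j → bit j (proj₁ p)) , (λ j → bit j (proj₂ p)) ]′ (F.splitAt n i)
  lookup-φ i (u , v) = lookup-splitAt n (bin n u) (bin n v) i

  literal-pullback : (b : Bool → Bool) (u₀ : Fin N) → (∀ j → T (b (bit j u₀))) →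
                     ∀ i → NonemptyUnionOf (𝓖 N) ((λ v → b (lookup v i)) ∘ φ n)
  literal-pullback b u₀ bu₀ i with F.splitAt n i in eq
  ... | inj₁ j = NonemptyUnionOf-resp (λ p → cong b (trans (lookup-φ i p) (cong [ _ , _ ]′ eq)))
                   (fibres-union proj₁ Row∈𝓖 (b ∘ bit j) (bu₀ j))
  ... | inj₂ j = NonemptyUnionOf-resp (λ p → cong b (trans (lookup-φ i p) (cong [ _ , _ ]′ eq)))
                   (fibres-union proj₂ Col∈𝓖 (b ∘ bit j) (bu₀ j))

  generators-pullback : All (λ X → NonemptyUnionOf (𝓖 N) (X ∘ φ n)) (𝓑cube (n + n))
  generators-pullback with lsbBits-ones n
  ... | m , m<N , ones = All-++⁺ (All-map⁺ (tabulate⁺ (literal-pullback id top top-bits)))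
                                 (All-map⁺ (tabulate⁺ (literal-pullback not bottom bottom-bits)))
    where
    top bottom : Fin N
    top    = F.fromℕ< m<N
    bottom = F.fromℕ< (m^n>0 2 n)
    top-bits : ∀ j → T (bit j top)
    top-bits j = Equivalence.from T-≡ (constant-bits m<N true ones j)
    bottom-bits : ∀ j → T (not (bit j bottom))
    bottom-bits j = Equivalence.from T-not-≡ (constant-bits (m^n>0 2 n) false (lsbBits-zero n) j)

lemma2p10 : (n : ℕ) → 1 ≤ n → (G : SubsetOf (Grid (2 ^ n))) → (k : ℕ) →
    DcapLe (image n G) (𝓑cube (n + n)) k → DcapLe G (𝓖 (2 ^ n)) k
lemma2p10 n _ G k image-generated =
  DcapLe-resp-≗ (image-φ n G) (DcapLe-pullback (φ n) (generators-pullback n) image-generated)
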